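{- The set of positive integers $n$ with $n^{1/2}\le S_s(n)$ has asymptotic density $1$.
   Context: $s(n)=\sigma(n)-n$ is the sum of proper divisors of $n$ and $S_s(n)=\sum_{d\mid n}s(d)$. -}

module Defs where

open import Data.Nat using (ℕ; suc; _∸_; _^_; _≤_; _≤?_)
open import Data.Nat.Divisibility using (_∣?_)
open import Data.List using (List; filter; applyUpTo; map; length)
open import Data.Nat.ListAction using (sum)

-- the positive divisors of n, i.e. the d ∈ {1,…,n} with d ∣ n  (empty for n = 0)
divisors : ℕ → List ℕ
divisors n = filter (_∣? n) (applyUpTo suc n)

σ : ℕ → ℕ
σ n = sum (divisors n)

-- s(n) = σ(n) − n, the sum of proper divisors (σ(n) ≥ n for n ≥ 1, so ∸ is exact)
s : ℕ → ℕ
s n = σ n ∸ n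

Ss : ℕ → ℕ
Ss n = sum (map s (divisors n))

-- membership in the set A = { n ≥ 1 : n^{1/2} ≤ S_s(n) }; for naturals,
-- √n ≤ m  ⇔  n ≤ m²
InA : ℕ → Set
InA n = n ≤ Ss n ^ 2

countA : ℕ → ℕ
countA x = length (filter (λ n → n ≤? Ss n ^ 2) (applyUpTo suc x))

{-# OPTIONS --safe #-}
-- A composite n has a divisor d with d < n ≤ d², and every proper divisor of n is at most
-- s(n) ≤ S_s(n); hence every n ∉ A with n > 1 is prime. Chebyshev's argument bounds the
-- primes: those in (n, 2n] divide the central binomial coefficient, which is at most 4ⁿ,
-- so there are at most 2n / t of them once 2ᵗ ≤ n. Halving x repeatedly then gives
-- t · #{n ≤ x : n ∉ A} ≤ 4x + O_t(1) for every t, which is density zero for the complement.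
module Submission where

open import Defs
open import Data.Bool using (true; false; if_then_else_)
open import Data.Nat
  using (ℕ; zero; suc; _+_; _*_; _∸_; _^_; _≤_; _<_; z≤n; s≤s; z<s; _≤?_; _<?_; _!; NonZero;
         ⌊_/2⌋; ⌈_/2⌉; _≤′_; ≤′-refl; ≤′-step)
open import Data.Nat.Base using (>-nonZero; ≢-nonZero; ≢-nonZero⁻¹; n>1⇒nonTrivial; nonTrivial⇒n>1)
open import Data.Nat.Properties
open import Data.Nat.Divisibility
  using (_∣_; _∤_; _∣?_; divides; ∣-refl; ∣-trans; ∣⇒≤; 0∣⇒≡0; ∣1⇒≡1; 1∣_; m∣m*n; m≤n⇒m!∣n!)
open import Data.Nat.Primality using (Prime; prime; Composite; composite; euclidsLemma; composite⇒nonZero)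
open import Data.Nat.Combinatorics
  using (_C_; nCk+nC[k+1]≡[n+1]C[k+1]; nCk≡n!/k![n-k]!; k![n∸k]!∣n!)
open import Data.Nat.DivMod using (m/n*n≡m)
open import Data.Nat.Induction using (<-rec)
open import Data.Nat.ListAction using (sum)
open import Data.Nat.Solver using (module +-*-Solver)
open import Data.List using ([]; _∷_; _∷ʳ_; _++_; filter; applyUpTo; length)
open import Data.List.Properties using (applyUpTo-∷ʳ; filter-++; length-++)
open import Data.List.Relation.Unary.Any using (here; there)
open import Data.List.Membership.Propositional using (_∈_)
open import Data.List.Membership.Propositional.Properties using (∈-map⁺; ∈-applyUpTo⁺; ∈-filter⁺)
open import Data.Product using (∃; _×_; _,_)
open import Data.Sum using (inj₁; inj₂)
open import Function using (_∘_)
open import Relation.Binary.PropositionalEquality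
open import Relation.Nullary using (¬_; Dec; does; yes; no; contradiction)
open import Relation.Nullary.Decidable using (¬?)
open import Relation.Unary using (Pred; Decidable)
open +-*-Solver

∈⇒≤sum : ∀ {x xs} → x ∈ xs → x ≤ sum xs
∈⇒≤sum {xs = y ∷ ys} (here refl) = m≤m+n y (sum ys)
∈⇒≤sum {xs = y ∷ ys} (there x∈ys) = ≤-trans (∈⇒≤sum x∈ys) (m≤n+m (sum ys) y)

≢-∈⇒+≤sum : ∀ {x y xs} → x ∈ xs → y ∈ xs → x ≢ y → x + y ≤ sum xs
≢-∈⇒+≤sum (here refl) (here refl) x≢y = contradiction refl x≢y
≢-∈⇒+≤sum {xs = z ∷ zs} (here refl) (there y∈zs) _ = +-monoʳ-≤ z (∈⇒≤sum y∈zs)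
≢-∈⇒+≤sum {x} {xs = z ∷ zs} (there x∈zs) (here refl) _ =
  subst (_≤ z + sum zs) (+-comm z x) (+-monoʳ-≤ z (∈⇒≤sum x∈zs))
≢-∈⇒+≤sum {xs = z ∷ zs} (there x∈zs) (there y∈zs) x≢y =
  ≤-trans (≢-∈⇒+≤sum x∈zs y∈zs x≢y) (m≤n+m (sum zs) z)

∣⇒∈divisors : ∀ {d n} .{{_ : NonZero n}} → d ∣ n → d ∈ divisors n
∣⇒∈divisors {zero} {n} 0∣n = contradiction (0∣⇒≡0 0∣n) (≢-nonZero⁻¹ n)
∣⇒∈divisors {suc i} {n} d∣n = ∈-filter⁺ (_∣? n) (∈-applyUpTo⁺ suc (∣⇒≤ d∣n)) d∣n

∣∧<⇒≤s : ∀ {d n} → d ∣ n → d < n → d ≤ s n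
∣∧<⇒≤s {zero} _ _ = z≤n
∣∧<⇒≤s {suc i} {n} d∣n d<n = m+n≤o⇒m≤o∸n (suc i)
  (≢-∈⇒+≤sum (∣⇒∈divisors d∣n) (∣⇒∈divisors ∣-refl) (<⇒≢ d<n))
  where instance _ = >-nonZero (m<n⇒0<n d<n)

s≤Ss : ∀ n .{{_ : NonZero n}} → s n ≤ Ss n
s≤Ss n = ∈⇒≤sum (∈-map⁺ s (∣⇒∈divisors ∣-refl))

composite⇒large-proper-divisor : ∀ {n} → Composite n → ∃ λ d → d ∣ n × d < n × n ≤ d * d
composite⇒large-proper-divisor {n} (composite {d} d<n (divides q n≡q*d)) with q ≤? d
... | yes q≤d = d , divides q n≡q*d , d<n , subst (_≤ d * d) (sym n≡q*d) (*-monoˡ-≤ d q≤d)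
... | no q≰d = q , divides d (trans n≡q*d (*-comm q d)) , q<n ,
               subst (_≤ q * q) (sym n≡q*d) (*-monoʳ-≤ q (<⇒≤ d<q))
  where
  d<q = ≰⇒> q≰d
  instance _ = >-nonZero (m<n⇒0<n d<q)
  q<n : q < n
  q<n = subst (q <_) (sym n≡q*d) (m<m*n q d (nonTrivial⇒n>1 d))

composite⇒InA : ∀ {n} → Composite n → InA n
composite⇒InA {n} c with composite⇒large-proper-divisor c
... | d , d∣n , d<n , n≤d*d = begin
  n             ≤⟨ n≤d*d ⟩
  d * d         ≤⟨ *-mono-≤ d≤Ss d≤Ss ⟩
  Ss n * Ss n   ≡⟨ cong (Ss n *_) (*-identityʳ (Ss n)) ⟨
  Ss n ^ 2      ∎
  where
  open ≤-Reasoning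
  instance _ = composite⇒nonZero c
  d≤Ss : d ≤ Ss n
  d≤Ss = ≤-trans (∣∧<⇒≤s d∣n d<n) (s≤Ss n)

¬InA⇒prime : ∀ {n} → 1 < n → ¬ InA n → Prime n
¬InA⇒prime 1<n n∉A = prime {{n>1⇒nonTrivial 1<n}} (n∉A ∘ composite⇒InA)

prime∤1 : ∀ {p} → Prime p → p ∤ 1
prime∤1 {p} (prime _) p∣1 = contradiction (∣1⇒≡1 p∣1) (>⇒≢ (nonTrivial⇒n>1 p))

prime∣m^n⇒p≤m : ∀ {p} m n .{{_ : NonZero m}} → Prime p → p ∣ m ^ n → p ≤ m
prime∣m^n⇒p≤m m zero pp p∣1 = contradiction p∣1 (prime∤1 pp)
prime∣m^n⇒p≤m m (suc n) pp p∣m^[1+n] with euclidsLemma m (m ^ n) pp p∣m^[1+n]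
... | inj₁ p∣m = ∣⇒≤ p∣m
... | inj₂ p∣m^n = prime∣m^n⇒p≤m m n pp p∣m^n

prime∣n!⇒p≤n : ∀ {p} n → Prime p → p ∣ n ! → p ≤ n
prime∣n!⇒p≤n zero pp p∣1 = contradiction p∣1 (prime∤1 pp)
prime∣n!⇒p≤n (suc n) pp p∣[1+n]! with euclidsLemma (suc n) (n !) pp p∣[1+n]!
... | inj₁ p∣1+n = ∣⇒≤ p∣1+n
... | inj₂ p∣n! = m≤n⇒m≤1+n (prime∣n!⇒p≤n n pp p∣n!)

0<m≤n⇒m∣n! : ∀ {m n} → 0 < m → m ≤ n → m ∣ n !
0<m≤n⇒m∣n! {suc i} _ m≤n = ∣-trans (m∣m*n (i !)) (m≤n⇒m!∣n! m≤n)

prime∣m∧n∣m∧p∤n⇒n*p∣m : ∀ {p m n} → Prime p → p ∣ m → n ∣ m → p ∤ n → n * p ∣ m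
prime∣m∧n∣m∧p∤n⇒n*p∣m {p} {m} {n} pp p∣m (divides q m≡q*n) p∤n
  with euclidsLemma q n pp (subst (p ∣_) m≡q*n p∣m)
... | inj₂ p∣n = contradiction p∣n p∤n
... | inj₁ (divides r q≡r*p) = divides r (begin
  m           ≡⟨ m≡q*n ⟩
  q * n       ≡⟨ cong (_* n) q≡r*p ⟩
  r * p * n   ≡⟨ solve 3 (λ r p n → r :* p :* n := r :* (n :* p)) refl r p n ⟩
  r * (n * p) ∎)
  where open ≡-Reasoning

nCk≤2^n : ∀ n k → n C k ≤ 2 ^ n
nCk≤2^n n zero = m^n>0 2 n
nCk≤2^n zero (suc k) = z≤n
nCk≤2^n (suc n) (suc k) = begin
  suc n C suc k       ≡⟨ nCk+nC[k+1]≡[n+1]C[k+1] n k ⟨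
  n C k + n C suc k   ≤⟨ +-mono-≤ (nCk≤2^n n k) (nCk≤2^n n (suc k)) ⟩
  2 ^ n + 2 ^ n       ≡⟨ cong (2 ^ n +_) (+-identityʳ (2 ^ n)) ⟨
  2 ^ suc n           ∎
  where open ≤-Reasoning

nCk*[k!*[n∸k]!]≡n! : ∀ {n k} → k ≤ n → (n C k) * (k ! * (n ∸ k) !) ≡ n !
nCk*[k!*[n∸k]!]≡n! {n} {k} k≤n = trans (cong (_* (k ! * (n ∸ k) !)) (nCk≡n!/k![n-k]! k≤n))
  (m/n*n≡m {{k !* (n ∸ k) !≢0}} (k![n∸k]!∣n! k≤n))

nCk≢0 : ∀ {n k} → k ≤ n → NonZero (n C k)
nCk≢0 {n} {k} k≤n = ≢-nonZero λ nCk≡0 → ≢-nonZero⁻¹ (n !) {{n !≢0}}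
  (trans (sym (nCk*[k!*[n∸k]!]≡n! k≤n)) (cong (_* (k ! * (n ∸ k) !)) nCk≡0))

prime∣nCk : ∀ {p n k} → Prime p → k < p → n ∸ k < p → p ≤ n → p ∣ n C k
prime∣nCk {p} {n} {k} pp k<p n∸k<p p≤n with euclidsLemma (n C k) (k ! * (n ∸ k) !) pp
  (subst (p ∣_) (sym (nCk*[k!*[n∸k]!]≡n! (<⇒≤ (<-≤-trans k<p p≤n))))
         (0<m≤n⇒m∣n! (m<n⇒0<n k<p) p≤n))
... | inj₁ p∣nCk = p∣nCk
... | inj₂ p∣k!*[n∸k]! with euclidsLemma (k !) ((n ∸ k) !) pp p∣k!*[n∸k]!
...   | inj₁ p∣k! = contradiction (prime∣n!⇒p≤n k pp p∣k!) (<⇒≱ k<p)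
...   | inj₂ p∣[n∸k]! = contradiction (prime∣n!⇒p≤n (n ∸ k) pp p∣[n∸k]!) (<⇒≱ n∸k<p)

n<2^n : ∀ n → n < 2 ^ n
n<2^n zero = z<s
n<2^n (suc n) = +-mono-≤ (m^n>0 2 n) (≤-trans (n<2^n n) (m≤m+n (2 ^ n) 0))

2^m≤2^n⇒m≤n : ∀ {m n} → 2 ^ m ≤ 2 ^ n → m ≤ n
2^m≤2^n⇒m≤n 2^m≤2^n = ≮⇒≥ λ n<m → <⇒≱ (^-monoʳ-< 2 (s≤s (s≤s z≤n)) n<m) 2^m≤2^n

⌈n/2⌉≤1+⌊n/2⌋ : ∀ n → ⌈ n /2⌉ ≤ suc ⌊ n /2⌋
⌈n/2⌉≤1+⌊n/2⌋ zero = z≤n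
⌈n/2⌉≤1+⌊n/2⌋ (suc zero) = s≤s z≤n
⌈n/2⌉≤1+⌊n/2⌋ (suc (suc n)) = s≤s (⌈n/2⌉≤1+⌊n/2⌋ n)

indicator : ∀ {p} {P : Set p} → Dec P → ℕ
indicator P? = if does P? then 1 else 0

indicator≤1 : ∀ {p} {P : Set p} (P? : Dec P) → indicator P? ≤ 1
indicator≤1 P? with does P?
... | true = ≤-refl
... | false = z≤n

module _ {q} {Q : Pred ℕ q} (Q? : Decidable Q) where

  -- countIn Q? n m = #{x | n < x ≤ n + m, Q x}  and  productIn Q? n m = ∏ {x | n < x ≤ n + m, Q x}
  countIn : ℕ → ℕ → ℕ
  countIn n zero = 0
  countIn n (suc m) = countIn n m + indicator (Q? (n + suc m))

  productIn : ℕ → ℕ → ℕ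
  productIn n zero = 1
  productIn n (suc m) = productIn n m * (n + suc m) ^ indicator (Q? (n + suc m))

  countIn≤ : ∀ n m → countIn n m ≤ m
  countIn≤ n zero = z≤n
  countIn≤ n (suc m) = subst (countIn n m + indicator (Q? (n + suc m)) ≤_) (+-comm m 1)
    (+-mono-≤ (countIn≤ n m) (indicator≤1 (Q? (n + suc m))))

  countIn-monoʳ : ∀ n {m m′} → m ≤ m′ → countIn n m ≤ countIn n m′
  countIn-monoʳ n = go ∘ ≤⇒≤′
    where
    go : ∀ {m m′} → m ≤′ m′ → countIn n m ≤ countIn n m′
    go ≤′-refl = ≤-refl
    go (≤′-step {m′} m≤m′) = ≤-trans (go m≤m′) (m≤m+n (countIn n m′) _)

  countIn-+ : ∀ n m → countIn 0 (n + m) ≡ countIn 0 n + countIn n m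
  countIn-+ n zero = trans (cong (countIn 0) (+-identityʳ n)) (sym (+-identityʳ (countIn 0 n)))
  countIn-+ n (suc m) rewrite +-suc n m | countIn-+ n m = +-assoc (countIn 0 n) (countIn n m) _

  length-filter-applyUpTo : ∀ x → length (filter Q? (applyUpTo suc x)) ≡ countIn 0 x
  length-filter-applyUpTo zero = refl
  length-filter-applyUpTo (suc x) = begin
    length (filter Q? (applyUpTo suc (suc x)))
      ≡⟨ cong (length ∘ filter Q?) (applyUpTo-∷ʳ suc x) ⟨
    length (filter Q? (applyUpTo suc x ∷ʳ suc x))
      ≡⟨ cong length (filter-++ Q? (applyUpTo suc x) (suc x ∷ [])) ⟩
    length (filter Q? (applyUpTo suc x) ++ filter Q? (suc x ∷ []))
      ≡⟨ length-++ (filter Q? (applyUpTo suc x)) ⟩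
    length (filter Q? (applyUpTo suc x)) + length (filter Q? (suc x ∷ []))
      ≡⟨ cong₂ _+_ (length-filter-applyUpTo x) (length-filter-[y] (suc x)) ⟩
    countIn 0 x + indicator (Q? (suc x))
      ∎
    where
    open ≡-Reasoning
    length-filter-[y] : ∀ y → length (filter Q? (y ∷ [])) ≡ indicator (Q? y)
    length-filter-[y] y with Q? y
    ... | yes _ = refl
    ... | no _ = refl

countIn-complement : ∀ {q} {Q : Pred ℕ q} (Q? : Decidable Q) n m →
                     countIn Q? n m + countIn (¬? ∘ Q?) n m ≡ m
countIn-complement Q? n zero = refl
countIn-complement Q? n (suc m) with Q? (n + suc m)
... | yes _ = trans (solve 2 (λ c c′ → (c :+ con 1) :+ (c′ :+ con 0) := con 1 :+ (c :+ c′)) refl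
                      (countIn Q? n m) (countIn (¬? ∘ Q?) n m))
                    (cong suc (countIn-complement Q? n m))
... | no _ = trans (solve 2 (λ c c′ → (c :+ con 0) :+ (c′ :+ con 1) := con 1 :+ (c :+ c′)) refl
                     (countIn Q? n m) (countIn (¬? ∘ Q?) n m))
                   (cong suc (countIn-complement Q? n m))

-- t plays the role of log₂ n: at most O(n / log n) elements of Q lie in each interval (n, 2n].
DyadicallySparse : ∀ {q} {Q : Pred ℕ q} → Decidable Q → Set
DyadicallySparse Q? = ∀ t n → 2 ^ t ≤ n → t * countIn Q? n n ≤ n + n

DensityZero : ∀ {q} {Q : Pred ℕ q} → Decidable Q → Set
DensityZero Q? = ∀ k → ∃ λ N → ∀ x → N ≤ x → suc k * countIn Q? 0 x ≤ x

module _ {q} {Q : Pred ℕ q} (Q? : Decidable Q) where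

  [1+n]^countIn≤productIn : ∀ n m → suc n ^ countIn Q? n m ≤ productIn Q? n m
  [1+n]^countIn≤productIn n zero = ≤-refl
  [1+n]^countIn≤productIn n (suc m) = begin
    suc n ^ (countIn Q? n m + i)        ≡⟨ ^-distribˡ-+-* (suc n) (countIn Q? n m) i ⟩
    suc n ^ countIn Q? n m * suc n ^ i  ≤⟨ *-mono-≤ ([1+n]^countIn≤productIn n m) (^-monoˡ-≤ i (m<m+n n z<s)) ⟩
    productIn Q? n m * (n + suc m) ^ i  ∎
    where
    open ≤-Reasoning
    i = indicator (Q? (n + suc m))

  prime>⇒∤productIn : ∀ {p} n m → Prime p → n + m < p → p ∤ productIn Q? n m
  prime>⇒∤productIn n zero pp _ = prime∤1 pp
  prime>⇒∤productIn n (suc m) pp n+[1+m]<p p∣P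
    with euclidsLemma (productIn Q? n m) ((n + suc m) ^ indicator (Q? (n + suc m))) pp p∣P
  ... | inj₁ p∣P′ = prime>⇒∤productIn n m pp (<-trans (+-monoʳ-< n (n<1+n m)) n+[1+m]<p) p∣P′
  ... | inj₂ p∣x^i = <⇒≱ n+[1+m]<p
    (prime∣m^n⇒p≤m (n + suc m) (indicator (Q? (n + suc m)))
                   {{>-nonZero (m<n⇒0<n (m<m+n n z<s))}} pp p∣x^i)

  module _ (Q⇒prime : ∀ {x} → 1 < x → Q x → Prime x) where

    productIn∣centralBinomial : ∀ n m → 0 < n → m ≤ n → productIn Q? n m ∣ (n + n) C n
    productIn∣centralBinomial n zero _ _ = 1∣ _
    productIn∣centralBinomial n (suc m) 0<n 1+m≤n with Q? (n + suc m)
    ... | no _ = subst (_∣ (n + n) C n) (sym (*-identityʳ (productIn Q? n m))) P∣C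
      where P∣C = productIn∣centralBinomial n m 0<n (<⇒≤ 1+m≤n)
    ... | yes Qx = subst (λ y → productIn Q? n m * y ∣ (n + n) C n) (sym (*-identityʳ x))
        (prime∣m∧n∣m∧p∤n⇒n*p∣m px x∣C P∣C (prime>⇒∤productIn n m px (+-monoʳ-< n (n<1+n m))))
      where
      P∣C = productIn∣centralBinomial n m 0<n (<⇒≤ 1+m≤n)
      x = n + suc m
      n<x : n < x
      n<x = m<m+n n z<s
      px : Prime x
      px = Q⇒prime (≤-trans (s≤s 0<n) n<x) Qx
      x∣C : x ∣ (n + n) C n
      x∣C = prime∣nCk px n<x (subst (_< x) (sym (m+n∸m≡n n n)) n<x) (+-monoʳ-≤ n 1+m≤n)

    primes-dyadicallySparse : DyadicallySparse Q?
    primes-dyadicallySparse t n 2^t≤n = 2^m≤2^n⇒m≤n (begin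
      2 ^ (t * c)       ≡⟨ ^-*-assoc 2 t c ⟨
      (2 ^ t) ^ c       ≤⟨ ^-monoˡ-≤ c (m≤n⇒m≤1+n 2^t≤n) ⟩
      suc n ^ c         ≤⟨ [1+n]^countIn≤productIn n n ⟩
      productIn Q? n n  ≤⟨ ∣⇒≤ {{nCk≢0 (m≤m+n n n)}} (productIn∣centralBinomial n n 0<n ≤-refl) ⟩
      (n + n) C n       ≤⟨ nCk≤2^n (n + n) n ⟩
      2 ^ (n + n)       ∎)
      where
      open ≤-Reasoning
      c = countIn Q? n n
      0<n = ≤-trans (m^n>0 2 t) 2^t≤n

module _ {q} {Q : Pred ℕ q} {Q? : Decidable Q} (sparse : DyadicallySparse Q?) (t : ℕ) where

  private
    T = countIn Q? 0
    K = t * (2 ^ t + 2 ^ t)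

  halving-step : ∀ a b → 2 ^ t ≤ a → a ≤ b → b ≤ suc a →
                 t * T a ≤ 4 * a + K → t * T (a + b) ≤ 4 * (a + b) + K
  halving-step a b 2^t≤a a≤b b≤1+a ih = begin
    t * T (a + b)                     ≡⟨ cong (t *_) (countIn-+ Q? a b) ⟩
    t * (T a + countIn Q? a b)        ≤⟨ *-monoʳ-≤ t (+-monoʳ-≤ (T a) count[a,b]≤) ⟩
    t * (T a + (countIn Q? a a + 1))  ≡⟨ solve 3 (λ t x y → t :* (x :+ (y :+ con 1)) := t :* x :+ t :* y :+ t)
                                               refl t (T a) (countIn Q? a a) ⟩
    t * T a + t * countIn Q? a a + t  ≤⟨ +-mono-≤ (+-mono-≤ ih (sparse t a 2^t≤a)) t≤a ⟩
    4 * a + K + (a + a) + a           ≡⟨ solve 2 (λ a K → con 4 :* a :+ K :+ (a :+ a) :+ a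
                                                       := con 4 :* a :+ con 3 :* a :+ K) refl a K ⟩
    4 * a + 3 * a + K                 ≤⟨ +-monoˡ-≤ K (+-monoʳ-≤ (4 * a) (*-mono-≤ (n≤1+n 3) a≤b)) ⟩
    4 * a + 4 * b + K                 ≡⟨ cong (_+ K) (*-distribˡ-+ 4 a b) ⟨
    4 * (a + b) + K                   ∎
    where
    open ≤-Reasoning
    count[a,b]≤ : countIn Q? a b ≤ countIn Q? a a + 1
    count[a,b]≤ = ≤-trans (countIn-monoʳ Q? a b≤1+a)
                          (+-monoʳ-≤ (countIn Q? a a) (indicator≤1 (Q? (a + suc a))))
    t≤a : t ≤ a
    t≤a = ≤-trans (<⇒≤ (n<2^n t)) 2^t≤a

  linear-bound : ∀ x → t * T x ≤ 4 * x + K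
  linear-bound = <-rec _ bound
    where
    bound : ∀ x → (∀ {y} → y < x → t * T y ≤ 4 * y + K) → t * T x ≤ 4 * x + K
    bound x ih with x <? 2 ^ t + 2 ^ t
    ... | yes x<2M = ≤-trans (*-monoʳ-≤ t (≤-trans (countIn≤ Q? 0 x) (<⇒≤ x<2M))) (m≤n+m K (4 * x))
    ... | no x≮2M = subst (λ y → t * T y ≤ 4 * y + K) (⌊n/2⌋+⌈n/2⌉≡n x)
        (halving-step a b 2^t≤a (⌊n/2⌋≤⌈n/2⌉ x) (⌈n/2⌉≤1+⌊n/2⌋ x) (ih a<x))
      where
      a = ⌊ x /2⌋
      b = ⌈ x /2⌉
      2^t≤a : 2 ^ t ≤ a
      2^t≤a = ≤-trans (≤-reflexive (n≡⌊n+n/2⌋ (2 ^ t))) (⌊n/2⌋-mono (≮⇒≥ x≮2M))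
      a<x : a < x
      a<x = subst (a <_) (⌊n/2⌋+⌈n/2⌉≡n x)
        (m<m+n a (<-≤-trans (m^n>0 2 t) (≤-trans 2^t≤a (⌊n/2⌋≤⌈n/2⌉ x))))

dyadicallySparse⇒densityZero : ∀ {q} {Q : Pred ℕ q} {Q? : Decidable Q} →
                               DyadicallySparse Q? → DensityZero Q?
dyadicallySparse⇒densityZero {Q? = Q?} sparse k = K , λ x K≤x → *-cancelˡ-≤ 5 (begin
  5 * (suc k * countIn Q? 0 x)  ≡⟨ *-assoc 5 (suc k) _ ⟨
  t * countIn Q? 0 x            ≤⟨ linear-bound sparse t x ⟩
  4 * x + K                     ≤⟨ +-monoʳ-≤ (4 * x) K≤x ⟩
  4 * x + x                     ≡⟨ +-comm (4 * x) x ⟩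
  5 * x                         ∎)
  where
  open ≤-Reasoning
  t = 5 * suc k
  K = t * (2 ^ t + 2 ^ t)

InA? : Decidable InA
InA? n = n ≤? Ss n ^ 2

x∸countA≡count¬InA : ∀ x → x ∸ countA x ≡ countIn (¬? ∘ InA?) 0 x
x∸countA≡count¬InA x = begin
  x ∸ countA x  ≡⟨ cong₂ _∸_ (countIn-complement InA? 0 x) (sym (length-filter-applyUpTo InA? x)) ⟨
  (c + c′) ∸ c  ≡⟨ m+n∸m≡n c c′ ⟩
  c′            ∎
  where
  open ≡-Reasoning
  c = countIn InA? 0 x
  c′ = countIn (¬? ∘ InA?) 0 x

lemma6p10 : (k : ℕ) → ∃ λ (N : ℕ) → (x : ℕ) → N ≤ x → suc k * (x ∸ countA x) ≤ x
lemma6p10 k with dyadicallySparse⇒densityZero (primes-dyadicallySparse (¬? ∘ InA?) ¬InA⇒prime) k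
... | N , density = N , λ x N≤x → subst (λ c → suc k * c ≤ x) (sym (x∸countA≡count¬InA x)) (density x N≤x)
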